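{- Let $\mathfrak F$ be a countable field and $E$ the $\mathfrak F$-vector space with basis $(e_n)$. Suppose $\mathcal A\subseteq E^\infty$, $V\subseteq E$ is an infinite-dimensional block subspace, $\vec v\in E^{<\infty}$ and $T\subseteq E^{<\infty}$ is a $(V,\vec v)$-rule. Then there is a block subspace $X\subseteq V$ such that for all $\vec x\in T$: there is a block subspace $Y\subseteq X$ such that I has a strategy in $B^T_Y(\vec x)$ to play in $\mathcal A$ if and only if for every block subspace $Y\subseteq X$, I has a strategy in $B^T_Y(\vec x)$ to play in $\mathcal A$.
   Context: For nonzero $x=\sum a_ne_n$, $\mathrm{supp}\,x=\{n:a_n\neq0\}$. A block sequence is a finite or infinite sequence of nonzero vectors with $\max\mathrm{supp}\,x_n<\min\mathrm{supp}\,x_{n+1}$. A block subspace is the span of an infinite block sequence (all subspaces below are such). $X[k]=\{x\in X\setminus\{0\}:k<\min\mathrm{supp}\,x\}$. $E$ is discrete, $E^\infty=E^{\mathbb N}$ has the product topology, $E^{<\infty}$ is the set of finite block sequences, $\frown$ is concatenation. All vectors played are nonzero. A $(V,\vec v)$-rule is $T\subseteq E^{<\infty}$ with $\vec v\in T$ such that (i) if $\vec y\in T$, $|\vec y|$ odd, then for every block subspace $Z\subseteq V$ there is $z\in Z$ with $\vec y\frown z\in T$; (ii) if $\vec y\in T$, $|\vec y|$ even, then there is $n$ with $\vec y\frown z\in T$ for all $z\in V[n]$. The game $B_Y(\vec x)$: if $|\vec x|$ is even, in rounds $k=0,1,\dots$, II plays a block subspace $Z_k\subseteq Y$, then I plays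 a vector $x_k\in Z_k$ and $n_k\in\mathbb N$, then II plays $y_k\in Y[n_k]$; the outcome is $\vec x\frown(x_0,y_0,x_1,y_1,\dots)$. If $|\vec x|$ is odd, I plays $n_0$; II plays $y_0\in Y[n_0]$ and $Z_0\subseteq Y$; I plays $x_0\in Z_0$ and $n_1$; II plays $y_1\in Y[n_1]$ and $Z_1$; etc.; the outcome is $\vec x\frown(y_0,x_0,y_1,x_1,\dots)$. The induced game $B^T_Y(\vec x)$ is $B_Y(\vec x)$ with the additional requirement that at every stage the finite sequence $\vec w$ of vectors played so far (in the order of the outcome) satisfies $\vec x\frown\vec w\in T$. "I has a strategy in a game to play in $\mathcal A$" means there is a strategy for I such that every run of the game in which I follows it has outcome in $\mathcal A$. -}

module Defs where

open import Level using (0ℓ)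
open import Data.Nat using (ℕ; zero; suc; _<_; _≤_; _%_) renaming (_+_ to _+ℕ_; _*_ to _*ℕ_)
open import Relation.Binary.PropositionalEquality using (_≡_)
open import Data.List.Relation.Binary.Pointwise using (Pointwise)
open import Data.Bool using (Bool; true; false; if_then_else_)
open import Data.Product using (Σ; ∃; _×_; _,_; proj₁; proj₂)
open import Data.List using (List; []; _∷_; _++_; [_]; length; applyUpTo)
open import Data.Unit using (⊤)
open import Relation.Nullary using (¬_)
open import Algebra.Bundles using (CommutativeRing)

record CountableField : Set₁ where
  field
    commRing : CommutativeRing 0ℓ 0ℓ
  open CommutativeRing commRing public
  field
    1≉0     : ¬ (1# ≈ 0#)
    inverse : ∀ a → ¬ (a ≈ 0#) → ∃ λ b → (a * b) ≈ 1#
    enum    : ℕ → Carrier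
    enum-surj : ∀ a → ∃ λ n → enum n ≈ a

module Space (𝔽 : CountableField) where
  open CountableField 𝔽

  record E : Set where
    field
      coef  : ℕ → Carrier
      bound : ℕ
      fin   : ∀ n → bound ≤ n → coef n ≈ 0#
  open E public

  _≈E_ : E → E → Set
  x ≈E y = ∀ n → coef x n ≈ coef y n

  _∈supp_ : ℕ → E → Set
  n ∈supp x = ¬ (coef x n ≈ 0#)

  NonZero : E → Set
  NonZero x = ∃ λ n → n ∈supp x

  _≺_ : E → E → Set
  x ≺ y = ∀ m n → m ∈supp x → n ∈supp y → m < n

  -- finite block sequences (the elements of E^{<∞})
  BlockFrom : E → List E → Set
  BlockFrom x []       = ⊤
  BlockFrom x (y ∷ ys) = x ≺ y × NonZero y × BlockFrom y ys

  IsBlockList : List E → Set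
  IsBlockList []       = ⊤
  IsBlockList (x ∷ xs) = NonZero x × BlockFrom x xs

  -- infinite block sequences; a block subspace is the span of one
  record BlockSeq : Set where
    field
      vec   : ℕ → E
      nz    : ∀ i → NonZero (vec i)
      block : ∀ i → vec i ≺ vec (suc i)
  open BlockSeq public

  lincomb : (ℕ → Carrier) → (ℕ → E) → ℕ → ℕ → Carrier
  lincomb c b zero    n = 0#
  lincomb c b (suc N) n = lincomb c b N n + (c N * coef (b N) n)

  _∈_ : E → BlockSeq → Set
  x ∈ Y = ∃ λ N → ∃ λ (c : ℕ → Carrier) →
            ∀ n → coef x n ≈ lincomb c (vec Y) N n

  _⊆_ : BlockSeq → BlockSeq → Set
  Y ⊆ X = ∀ x → x ∈ Y → x ∈ X

  _∈_⟦_⟧ : E → BlockSeq → ℕ → Set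
  x ∈ Y ⟦ k ⟧ = x ∈ Y × NonZero x × (∀ m → m ∈supp x → k < m)

  isEven : ℕ → Bool
  isEven n with n % 2
  ... | zero = true
  ... | suc _ = false

  record IsRule (V : BlockSeq) (v : List E) (T : List E → Set) : Set where
    field
      blocks : ∀ ys → T ys → IsBlockList ys
      start  : T v
      odd    : ∀ ys → T ys → isEven (length ys) ≡ false →
                 ∀ Z → Z ⊆ V → ∃ λ z → z ∈ Z × NonZero z × T (ys ++ [ z ])
      even   : ∀ ys → T ys → isEven (length ys) ≡ true →
                 ∃ λ n → ∀ z → z ∈ V ⟦ n ⟧ → T (ys ++ [ z ])

  prepend : List E → (ℕ → E) → ℕ → E
  prepend []       w n       = w n
  prepend (x ∷ xs) w zero    = x
  prepend (x ∷ xs) w (suc n) = prepend xs w n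

  interleave : (ℕ → E) → (ℕ → E) → ℕ → E
  interleave f g zero    = f 0
  interleave f g (suc m) = interleave g (λ i → f (suc i)) m

  -- Strategies for I in B_Y(x⃗), |x⃗| even.  I sees the previous rounds
  -- (Z_j , y_j)_{j<k} and the current Z_k, and answers (x_k , n_k).
  StratEven : Set
  StratEven = List (BlockSeq × E) → BlockSeq → E × ℕ

  module EvenRun (σ : StratEven) (Zs : ℕ → BlockSeq) (ys : ℕ → E) where
    hist : ℕ → List (BlockSeq × E)
    hist = applyUpTo (λ j → Zs j , ys j)
    xs : ℕ → E
    xs k = proj₁ (σ (hist k) (Zs k))
    ns : ℕ → ℕ
    ns k = proj₂ (σ (hist k) (Zs k))
    out : ℕ → E
    out = interleave xs ys

  -- Strategies for I in B_Y(x⃗), |x⃗| odd: an initial n_0, then, seeing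
  -- (y_j , Z_j)_{j≤k}, I answers (x_k , n_{k+1}).
  record StratOdd : Set where
    field
      n₀ : ℕ
      σ  : List (E × BlockSeq) → E × ℕ

  module OddRun (τ : StratOdd) (Zs : ℕ → BlockSeq) (ys : ℕ → E) where
    open StratOdd τ
    hist : ℕ → List (E × BlockSeq)
    hist = applyUpTo (λ j → ys j , Zs j)
    xs : ℕ → E
    xs k = proj₁ (σ (hist (suc k)))
    ns : ℕ → ℕ
    ns zero    = n₀
    ns (suc k) = proj₂ (σ (hist (suc k)))
    out : ℕ → E
    out = interleave ys xs

  -- "I has a strategy in B^T_Y(x⃗) to play in 𝒜": at each stage, if II
  -- has played legally so far, I's move (given by the strategy) is legal;
  -- and every run in which II plays legally throughout has outcome in 𝒜.
  -- Legality includes the T-requirement  x⃗ ⌢ w⃗ ∈ T  for the vectors w⃗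
  -- played so far.
  IWinsEven : (T : List E → Set) (𝒜 : (ℕ → E) → Set) → BlockSeq → List E → Set
  IWinsEven T 𝒜 Y x = ∃ λ (σ : StratEven) →
      (∀ Zs ys k → let open EvenRun σ Zs ys in
         (∀ j → j ≤ k → Zs j ⊆ Y) →
         (∀ j → j < k → ys j ∈ Y ⟦ ns j ⟧ × T (x ++ applyUpTo out (2 *ℕ j +ℕ 2))) →
         xs k ∈ Zs k × NonZero (xs k) × T (x ++ applyUpTo out (2 *ℕ k +ℕ 1)))
    × (∀ Zs ys → let open EvenRun σ Zs ys in
         (∀ j → Zs j ⊆ Y × ys j ∈ Y ⟦ ns j ⟧ × T (x ++ applyUpTo out (2 *ℕ j +ℕ 2))) →
         𝒜 (prepend x out))

  IWinsOdd : (T : List E → Set) (𝒜 : (ℕ → E) → Set) → BlockSeq → List E → Set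
  IWinsOdd T 𝒜 Y x = ∃ λ (τ : StratOdd) →
      (∀ Zs ys k → let open OddRun τ Zs ys in
         (∀ j → j ≤ k → ys j ∈ Y ⟦ ns j ⟧ × T (x ++ applyUpTo out (2 *ℕ j +ℕ 1)) × Zs j ⊆ Y) →
         xs k ∈ Zs k × NonZero (xs k) × T (x ++ applyUpTo out (2 *ℕ k +ℕ 2)))
    × (∀ Zs ys → let open OddRun τ Zs ys in
         (∀ j → ys j ∈ Y ⟦ ns j ⟧ × T (x ++ applyUpTo out (2 *ℕ j +ℕ 1)) × Zs j ⊆ Y) →
         𝒜 (prepend x out))

  IHasStrategy : (T : List E → Set) (𝒜 : (ℕ → E) → Set) → BlockSeq → List E → Set
  IHasStrategy T 𝒜 Y x =
    if isEven (length x) then IWinsEven T 𝒜 Y x else IWinsOdd T 𝒜 Y x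

  -- subsets of E^{<∞} and E^∞ are sets of vectors: respect ≈E
  ExtT : (List E → Set) → Set
  ExtT T = ∀ xs ys → Pointwise _≈E_ xs ys → T xs → T ys

  ExtA : ((ℕ → E) → Set) → Set
  ExtA 𝒜 = ∀ f g → (∀ n → f n ≈E g n) → 𝒜 f → 𝒜 g

-- Enumerate E^{<∞} up to ≈E as c₀, c₁, … (𝔽 is countable). Starting from
-- X₀ = V, let X_{n+1} ⊆ Xₙ be a block subspace on which I has a strategy in
-- B^T(cₙ) if Xₙ contains one, and X_{n+1} = Xₙ otherwise. The diagonal block
-- sequence X, whose n-th vector is taken from Xₙ beyond the support of the
-- previous one, satisfies: every vector of X supported beyond threshold n lies
-- in Xₙ. A strategy of I for B_W yields one for B_Y whenever all vectors of Y
-- supported beyond some m lie in W. So if I has a strategy on some Y₀ ⊆ X for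
-- x ≈ cₙ, he has one on a tail of Y₀ inside Xₙ, hence on X_{n+1}, hence on
-- every Y ⊆ X.

module Submission where

open import Defs
open import Level using (0ℓ)
open import Algebra.Properties.CommutativeSemigroup using (interchange)
open import Axiom.DoubleNegationElimination using (em⇒dne)
open import Axiom.ExcludedMiddle using (ExcludedMiddle)
open import Data.Bool using (true; false)
open import Data.List using (List; []; _∷_; _++_; length; applyUpTo; map)
open import Data.List.Properties using (map-applyUpTo)
open import Data.List.Relation.Binary.Pointwise as Pointwise using (Pointwise; []; _∷_)
open import Data.Nat
  using (ℕ; zero; suc; _<_; _≤_; _≤′_; ≤′-refl; ≤′-step; _⊔_; z≤n; s≤s; _<?_; _≟_; _≤?_)
  renaming (_+_ to _+ℕ_; _*_ to _*ℕ_)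
import Data.Nat.Properties as ℕ
open import Data.Product using (Σ; ∃; _×_; _,_; proj₁; proj₂; uncurry; map₁; map₂)
open import Function.Base using (_∘_; const)
open import Function.Bundles using (_⇔_; mk⇔)
open import Relation.Binary.PropositionalEquality as ≡ using (_≡_; _≗_)
open import Relation.Nullary using (¬_; yes; no; contradiction)
import Relation.Binary.Reasoning.Setoid as SetoidReasoning

applyUpTo-cong : ∀ {A : Set} {f g : ℕ → A} → f ≗ g → ∀ n → applyUpTo f n ≡ applyUpTo g n
applyUpTo-cong f≗g zero    = ≡.refl
applyUpTo-cong f≗g (suc n) = ≡.cong₂ _∷_ (f≗g 0) (applyUpTo-cong (f≗g ∘ suc) n)

-- Runs through the antidiagonals: (0,0), (1,0), (0,1), (2,0), (1,1), (0,2), …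
nextPair : ℕ × ℕ → ℕ × ℕ
nextPair (zero  , b) = suc b , 0
nextPair (suc a , b) = a , suc b

unpair : ℕ → ℕ × ℕ
unpair zero    = 0 , 0
unpair (suc n) = nextPair (unpair n)

private
  Reached : ℕ × ℕ → Set
  Reached q = ∃ λ n → unpair n ≡ q

  reached-next : ∀ q → Reached q → Reached (nextPair q)
  reached-next q (n , eq) = suc n , ≡.cong nextPair eq

  reached-antidiagonal : ∀ b a → Reached (b +ℕ a , 0) → Reached (a , b)
  reached-antidiagonal zero    a r = r
  reached-antidiagonal (suc b) a r = reached-next (suc a , b)
    (reached-antidiagonal b (suc a) (≡.subst (λ s → Reached (s , 0)) (≡.sym (ℕ.+-suc b a)) r))

  reached-axis : ∀ s → Reached (s , 0)
  reached-axis zero    = 0 , ≡.refl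
  reached-axis (suc s) = reached-next (0 , s)
    (reached-antidiagonal s 0 (≡.subst (λ t → Reached (t , 0)) (≡.sym (ℕ.+-identityʳ s)) (reached-axis s)))

unpair-surjective : ∀ a b → ∃ λ n → unpair n ≡ (a , b)
unpair-surjective a b = reached-antidiagonal b a (reached-axis (b +ℕ a))

module _ {A : Set} (f : ℕ → A) where

  decodeList : ℕ → ℕ → List A
  decodeList zero    c = []
  decodeList (suc k) c = f (proj₁ (unpair c)) ∷ decodeList k (proj₂ (unpair c))

  listAt : ℕ → List A
  listAt n = uncurry decodeList (unpair n)

  module _ (R : A → A → Set) (f-surjective : ∀ a → ∃ λ i → R (f i) a) where

    decodeList-surjective : ∀ xs → ∃ λ c → Pointwise R (decodeList (length xs) c) xs
    decodeList-surjective [] = 0 , []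
    decodeList-surjective (a ∷ xs) with f-surjective a | decodeList-surjective xs
    ... | i , fi≈a | c′ , rest with unpair-surjective i c′
    ... | c , eq = c , ≡.subst (λ l → Pointwise R l (a ∷ xs))
      (≡.cong (λ q → f (proj₁ q) ∷ decodeList (length xs) (proj₂ q)) (≡.sym eq)) (fi≈a ∷ rest)

    listAt-surjective : ∀ xs → ∃ λ n → Pointwise R (listAt n) xs
    listAt-surjective xs with decodeList-surjective xs
    ... | c , pw with unpair-surjective (length xs) c
    ... | n , eq = n , ≡.subst (λ l → Pointwise R l xs) (≡.cong (uncurry decodeList) (≡.sym eq)) pw

module _ (𝔽 : CountableField) where
  open CountableField 𝔽
  open Space 𝔽
  open SetoidReasoning setoid

  ≡⇒≈E : ∀ {u v} → u ≡ v → u ≈E v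
  ≡⇒≈E ≡.refl p = refl

  Pointwise-≈E-refl : ∀ {xs} → Pointwise _≈E_ xs xs
  Pointwise-≈E-refl = Pointwise.refl λ p → refl

  Pointwise-≈E-sym : ∀ {xs ys} → Pointwise _≈E_ xs ys → Pointwise _≈E_ ys xs
  Pointwise-≈E-sym = Pointwise.symmetric λ u≈v p → sym (u≈v p)

  lincomb-cong : ∀ {c c′ b b′} N p →
    (∀ j → j < N → c j * coef (b j) p ≈ c′ j * coef (b′ j) p) →
    lincomb c b N p ≈ lincomb c′ b′ N p
  lincomb-cong zero    p eq = refl
  lincomb-cong (suc N) p eq =
    +-cong (lincomb-cong N p (λ j j<N → eq j (ℕ.m<n⇒m<1+n j<N))) (eq N ℕ.≤-refl)

  lincomb-zero : ∀ {c b} N p → (∀ j → j < N → c j * coef (b j) p ≈ 0#) → lincomb c b N p ≈ 0#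
  lincomb-zero zero    p eq = refl
  lincomb-zero (suc N) p eq =
    trans (+-cong (lincomb-zero N p (λ j j<N → eq j (ℕ.m<n⇒m<1+n j<N))) (eq N ℕ.≤-refl)) (+-identityˡ 0#)

  lincomb-+ : ∀ c c′ b N p → lincomb (λ j → c j + c′ j) b N p ≈ lincomb c b N p + lincomb c′ b N p
  lincomb-+ c c′ b zero    p = sym (+-identityʳ 0#)
  lincomb-+ c c′ b (suc N) p =
    trans (+-cong (lincomb-+ c c′ b N p) (distribʳ _ _ _)) (interchange +-commutativeSemigroup _ _ _ _)

  lincomb-* : ∀ a c b N p → lincomb (λ j → a * c j) b N p ≈ a * lincomb c b N p
  lincomb-* a c b zero    p = sym (zeroʳ a)
  lincomb-* a c b (suc N) p = trans (+-cong (lincomb-* a c b N p) (*-assoc _ _ _)) (sym (distribˡ _ _ _))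

  lincomb-split : ∀ c b n K p →
    lincomb c b (K +ℕ n) p ≈ lincomb c b n p + lincomb (λ j → c (j +ℕ n)) (λ j → b (j +ℕ n)) K p
  lincomb-split c b n zero    p = sym (+-identityʳ _)
  lincomb-split c b n (suc K) p = trans (+-cong (lincomb-split c b n K p) refl) (+-assoc _ _ _)

  pad : (ℕ → Carrier) → ℕ → ℕ → Carrier
  pad c N j with j <? N
  ... | yes _ = c j
  ... | no  _ = 0#

  lincomb-pad : ∀ c b {N K} p → N ≤′ K → lincomb (pad c N) b K p ≈ lincomb c b N p
  lincomb-pad c b {N} p ≤′-refl = lincomb-cong N p agree
    where
    agree : ∀ j → j < N → pad c N j * coef (b j) p ≈ c j * coef (b j) p
    agree j j<N with j <? N
    ... | yes _   = refl
    ... | no  j≮N = contradiction j<N j≮N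
  lincomb-pad c b {N} p (≤′-step {K} N≤′K) = begin
    lincomb (pad c N) b K p + pad c N K * coef (b K) p ≈⟨ +-cong (lincomb-pad c b p N≤′K) vanish ⟩
    lincomb c b N p + 0#                                ≈⟨ +-identityʳ _ ⟩
    lincomb c b N p                                     ∎
    where
    vanish : pad c N K * coef (b K) p ≈ 0#
    vanish with K <? N
    ... | yes K<N = contradiction (ℕ.≤-trans K<N (ℕ.≤′⇒≤ N≤′K)) (ℕ.n≮n K)
    ... | no  _   = zeroˡ _

  Spanned : (ℕ → E) → (ℕ → Carrier) → Set
  Spanned b f = ∃ λ N → ∃ λ c → ∀ p → f p ≈ lincomb c b N p

  spanned-resp : ∀ {b f g} → (∀ p → f p ≈ g p) → Spanned b f → Spanned b g
  spanned-resp f≈g (N , c , eq) = N , c , λ p → trans (sym (f≈g p)) (eq p)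

  spanned-+ : ∀ {b f g} → Spanned b f → Spanned b g → Spanned b (λ p → f p + g p)
  spanned-+ {b} {f} {g} (N , c , eqf) (M , d , eqg) = N +ℕ M , (λ j → pad c N j + pad d M j) , λ p → begin
    f p + g p                                                        ≈⟨ +-cong (eqf p) (eqg p) ⟩
    lincomb c b N p + lincomb d b M p
      ≈⟨ +-cong (lincomb-pad c b p (ℕ.m≤′m+n N M)) (lincomb-pad d b p (ℕ.≤⇒≤′ (ℕ.m≤n+m M N))) ⟨
    lincomb (pad c N) b (N +ℕ M) p + lincomb (pad d M) b (N +ℕ M) p
      ≈⟨ lincomb-+ (pad c N) (pad d M) b (N +ℕ M) p ⟨
    lincomb (λ j → pad c N j + pad d M j) b (N +ℕ M) p               ∎

  spanned-* : ∀ {b f} a → Spanned b f → Spanned b (λ p → a * f p)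
  spanned-* {b} a (N , c , eq) = N , (λ j → a * c j) , λ p →
    trans (*-cong refl (eq p)) (sym (lincomb-* a c b N p))

  spanned-lincomb : ∀ {b b′} c N → (∀ j → Spanned b (coef (b′ j))) → Spanned b (lincomb c b′ N)
  spanned-lincomb c zero    spans = 0 , c , λ p → refl
  spanned-lincomb c (suc N) spans = spanned-+ (spanned-lincomb c N spans) (spanned-* (c N) (spans N))

  unit : ℕ → ℕ → Carrier
  unit i j with j ≟ i
  ... | yes _ = 1#
  ... | no  _ = 0#

  spanned-generator : ∀ b i → Spanned b (coef (b i))
  spanned-generator b i = suc i , unit i , λ p → sym (begin
    lincomb (unit i) b i p + unit i i * coef (b i) p ≈⟨ +-cong (lincomb-zero i p (before p)) (*-cong at-i refl) ⟩
    0# + 1# * coef (b i) p                            ≈⟨ +-identityˡ _ ⟩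
    1# * coef (b i) p                                 ≈⟨ *-identityˡ _ ⟩
    coef (b i) p                                      ∎)
    where
    before : ∀ p j → j < i → unit i j * coef (b j) p ≈ 0#
    before p j j<i with j ≟ i
    ... | yes ≡.refl = contradiction j<i (ℕ.n≮n j)
    ... | no  _      = zeroˡ _
    at-i : unit i i ≈ 1#
    at-i with i ≟ i
    ... | yes _   = refl
    ... | no  i≢i = contradiction ≡.refl i≢i

  vec∈ : ∀ Z i → vec Z i ∈ Z
  vec∈ Z = spanned-generator (vec Z)

  ⊆-refl : ∀ {Z} → Z ⊆ Z
  ⊆-refl z z∈Z = z∈Z

  ⊆-from-vec∈ : ∀ Z W → (∀ i → vec Z i ∈ W) → Z ⊆ W
  ⊆-from-vec∈ Z W vecs∈W x (N , c , eq) = spanned-resp (λ p → sym (eq p)) (spanned-lincomb c N vecs∈W)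

  supp<bound : ∀ x {s} → s ∈supp x → s < bound x
  supp<bound x {s} s∈x with bound x ≤? s
  ... | yes bound≤s = contradiction (fin x s bound≤s) s∈x
  ... | no  bound≰s = ℕ.≰⇒> bound≰s

  index≤supp : ∀ Z i {s} → s ∈supp vec Z i → i ≤ s
  index≤supp Z zero    _   = z≤n
  index≤supp Z (suc i) s∈ with nz Z i
  ... | t , t∈ = ℕ.≤-<-trans (index≤supp Z i t∈) (block Z i _ _ t∈ s∈)

  drop : ℕ → BlockSeq → BlockSeq
  drop n Z = record
    { vec = λ i → vec Z (i +ℕ n) ; nz = λ i → nz Z (i +ℕ n) ; block = λ i → block Z (i +ℕ n) }

  drop-⊆ : ∀ n Z → drop n Z ⊆ Z
  drop-⊆ n Z = ⊆-from-vec∈ (drop n Z) Z (λ i → vec∈ Z (i +ℕ n))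

  record _⊆[_]_ (Y : BlockSeq) (m : ℕ) (W : BlockSeq) : Set where
    constructor mk⊆[]
    field ⊆[]-∈ : ∀ z → z ∈ Y ⟦ m ⟧ → z ∈ W
  open _⊆[_]_

  ⊆⇒⊆[] : ∀ {Y W} m → Y ⊆ W → Y ⊆[ m ] W
  ⊆⇒⊆[] m Y⊆W = mk⊆[] λ z z∈ → Y⊆W z (proj₁ z∈)

  ⊆-⊆[]-trans : ∀ {Y X W m} → Y ⊆ X → X ⊆[ m ] W → Y ⊆[ m ] W
  ⊆-⊆[]-trans Y⊆X X⊆W = mk⊆[] λ z (z∈Y , rest) → ⊆[]-∈ X⊆W z (Y⊆X z z∈Y , rest)

  drop-suc-⊆ : ∀ {Z W m} → Z ⊆[ m ] W → drop (suc m) Z ⊆ W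
  drop-suc-⊆ {Z} {W} {m} Z⊆W = ⊆-from-vec∈ (drop (suc m) Z) W λ i →
    ⊆[]-∈ Z⊆W (vec Z (i +ℕ suc m))
      (vec∈ Z _ , nz Z _ , λ s s∈ → ℕ.≤-trans (ℕ.m≤n+m (suc m) i) (index≤supp Z _ s∈))

  ⊆[]-⟦⊔⟧ : ∀ {Y W m} → Y ⊆[ m ] W → ∀ y n → y ∈ Y ⟦ n ⊔ m ⟧ → y ∈ W ⟦ n ⟧
  ⊆[]-⟦⊔⟧ {m = m} Y⊆W y n (y∈Y , y≢0 , above) =
    ⊆[]-∈ Y⊆W y (y∈Y , y≢0 , λ s s∈ → ℕ.≤-<-trans (ℕ.m≤n⊔m n m) (above s s∈)) ,
    y≢0 , λ s s∈ → ℕ.≤-<-trans (ℕ.m≤m⊔n n m) (above s s∈)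

  ∈-drop : ∀ {z} X n t →
    (∀ i p → i < n → t ≤ p → coef (vec X i) p ≈ 0#) →
    (∀ j p → p < t → coef (vec X (j +ℕ n)) p ≈ 0#) →
    (∀ p → p < t → coef z p ≈ 0#) →
    z ∈ X → z ∈ drop n X
  ∈-drop {z} X n t head-high tail-low z-low (N , c , eq) = N , (λ j → pad c N (j +ℕ n)) , coef≈
    where
    coef≈ : ∀ p → coef z p ≈ lincomb (λ j → pad c N (j +ℕ n)) (vec (drop n X)) N p
    coef≈ p with p <? t
    ... | yes p<t = trans (z-low p p<t)
      (sym (lincomb-zero N p (λ j _ → trans (*-cong refl (tail-low j p p<t)) (zeroʳ _))))
    ... | no  p≮t = begin
      coef z p                                        ≈⟨ eq p ⟩
      lincomb c (vec X) N p                           ≈⟨ lincomb-pad c (vec X) p (ℕ.≤⇒≤′ (ℕ.m≤m+n N n)) ⟨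
      lincomb (pad c N) (vec X) (N +ℕ n) p            ≈⟨ lincomb-split (pad c N) (vec X) n N p ⟩
      lincomb (pad c N) (vec X) n p + tail            ≈⟨ +-cong (lincomb-zero n p head-zero) refl ⟩
      0# + tail                                       ≈⟨ +-identityˡ _ ⟩
      tail                                            ∎
      where
      tail : Carrier
      tail = lincomb (λ j → pad c N (j +ℕ n)) (vec (drop n X)) N p
      head-zero : ∀ i → i < n → pad c N i * coef (vec X i) p ≈ 0#
      head-zero i i<n = trans (*-cong refl (head-high i p i<n (ℕ.≮⇒≥ p≮t))) (zeroʳ _)

  coefAt : List Carrier → ℕ → Carrier
  coefAt []       p       = 0#
  coefAt (a ∷ as) zero    = a
  coefAt (a ∷ as) (suc p) = coefAt as p

  coefAt-vanishes : ∀ as p → length as ≤ p → coefAt as p ≈ 0#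
  coefAt-vanishes []       p       _         = refl
  coefAt-vanishes (a ∷ as) (suc p) (s≤s len≤p) = coefAt-vanishes as p len≤p

  fromCoefs : List Carrier → E
  fromCoefs as = record { coef = coefAt as ; bound = length as ; fin = coefAt-vanishes as }

  coefAt-cong : ∀ {as bs} → Pointwise _≈_ as bs → ∀ p → coefAt as p ≈ coefAt bs p
  coefAt-cong []            p       = refl
  coefAt-cong (a≈b ∷ as≈bs) zero    = a≈b
  coefAt-cong (a≈b ∷ as≈bs) (suc p) = coefAt-cong as≈bs p

  coefAt-applyUpTo : ∀ {f} k → (∀ p → k ≤ p → f p ≈ 0#) → ∀ p → coefAt (applyUpTo f k) p ≈ f p
  coefAt-applyUpTo         zero    f-vanishes p       = sym (f-vanishes p z≤n)
  coefAt-applyUpTo         (suc k) f-vanishes zero    = refl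
  coefAt-applyUpTo {f = f} (suc k) f-vanishes (suc p) =
    coefAt-applyUpTo {f = f ∘ suc} k (λ q k≤q → f-vanishes (suc q) (s≤s k≤q)) p

  vectorAt : ℕ → E
  vectorAt = fromCoefs ∘ listAt enum

  vectorAt-surjective : ∀ x → ∃ λ n → vectorAt n ≈E x
  vectorAt-surjective x with listAt-surjective enum _≈_ enum-surj (applyUpTo (coef x) (bound x))
  ... | n , coefs≈ = n , λ p → trans (coefAt-cong coefs≈ p) (coefAt-applyUpTo (bound x) (fin x) p)

  codeAt : ℕ → List E
  codeAt = listAt vectorAt

  codeAt-surjective : ∀ xs → ∃ λ n → Pointwise _≈E_ (codeAt n) xs
  codeAt-surjective = listAt-surjective vectorAt _≈E_ vectorAt-surjective

  interleave-cong : ∀ {f f′ g g′} → f ≗ f′ → g ≗ g′ → interleave f g ≗ interleave f′ g′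
  interleave-cong f≗f′ g≗g′ zero    = f≗f′ 0
  interleave-cong f≗f′ g≗g′ (suc n) = interleave-cong g≗g′ (f≗f′ ∘ suc) n

  prepend-cong : ∀ xs {f g} → f ≗ g → ∀ n → prepend xs f n ≈E prepend xs g n
  prepend-cong []       f≗g n       = ≡⇒≈E (f≗g n)
  prepend-cong (x ∷ xs) f≗g zero    = λ p → refl
  prepend-cong (x ∷ xs) f≗g (suc n) = prepend-cong xs f≗g n

  prepend-resp : ∀ {xs xs′} f → Pointwise _≈E_ xs xs′ → ∀ n → prepend xs f n ≈E prepend xs′ f n
  prepend-resp f []              n       = λ p → refl
  prepend-resp f (x≈x′ ∷ xs≈xs′) zero    = x≈x′
  prepend-resp f (x≈x′ ∷ xs≈xs′) (suc n) = prepend-resp f xs≈xs′ n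

  module Strategies (T : List E → Set) (𝒜 : (ℕ → E) → Set) (ext𝒜 : ExtA 𝒜) where

    -- If Y ⊆[ m ] W, a strategy of I on W is turned into one on Y: I replaces
    -- each subspace Z ⊆ Y offered by II by drop (suc m) Z ⊆ W, and raises each
    -- of his numbers to at least m, so that II's vectors lie in W.
    module Transfer (x : List E) {Y W : BlockSeq} {m : ℕ} (Y⊆W : Y ⊆[ m ] W) where

      shrink : BlockSeq → BlockSeq
      shrink = drop (suc m)

      shrink-⊆ : ∀ Z → Z ⊆ Y → shrink Z ⊆ W
      shrink-⊆ Z Z⊆Y = drop-suc-⊆ (⊆-⊆[]-trans {Z} Z⊆Y Y⊆W)

      T-transport : ∀ {f g} → f ≗ g → ∀ n → T (x ++ applyUpTo f n) → T (x ++ applyUpTo g n)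
      T-transport f≗g n = ≡.subst (λ l → T (x ++ l)) (applyUpTo-cong f≗g n)

      evenT : IWinsEven T 𝒜 W x → IWinsEven T 𝒜 Y x
      evenT (σ , legal , wins) = σ′ , Compare.legal′ , Compare.wins′
        where
        retarget : BlockSeq × E → BlockSeq × E
        retarget (Z , y) = shrink Z , y

        move : List (BlockSeq × E) → BlockSeq → E × ℕ
        move h Z = σ (map retarget h) (shrink Z)

        σ′ : StratEven
        σ′ h Z = proj₁ (move h Z) , proj₂ (move h Z) ⊔ m

        module Compare (Zs : ℕ → BlockSeq) (ys : ℕ → E) where
          module R′ = EvenRun σ′ Zs ys
          module R  = EvenRun σ (shrink ∘ Zs) ys

          same-move : ∀ k → move (R′.hist k) (Zs k) ≡ σ (R.hist k) (shrink (Zs k))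
          same-move k = ≡.cong (λ h → σ h (shrink (Zs k))) (map-applyUpTo _ retarget k)

          same-xs : ∀ k → R′.xs k ≡ R.xs k
          same-xs k = ≡.cong proj₁ (same-move k)

          same-out : R′.out ≗ R.out
          same-out = interleave-cong same-xs (λ _ → ≡.refl)

          y-legal : ∀ j → ys j ∈ Y ⟦ R′.ns j ⟧ → ys j ∈ W ⟦ R.ns j ⟧
          y-legal j y∈ = ⊆[]-⟦⊔⟧ Y⊆W (ys j) (R.ns j)
            (≡.subst (λ n → ys j ∈ Y ⟦ n ⟧) (≡.cong (λ r → proj₂ r ⊔ m) (same-move j)) y∈)

          legal′ : ∀ k → (∀ j → j ≤ k → Zs j ⊆ Y) →
            (∀ j → j < k → ys j ∈ Y ⟦ R′.ns j ⟧ × T (x ++ applyUpTo R′.out (2 *ℕ j +ℕ 2))) →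
            R′.xs k ∈ Zs k × NonZero (R′.xs k) × T (x ++ applyUpTo R′.out (2 *ℕ k +ℕ 1))
          legal′ k Zs⊆Y ys-legal with legal (shrink ∘ Zs) ys k (λ j j≤k → shrink-⊆ (Zs j) (Zs⊆Y j j≤k))
            (λ j j<k → y-legal j (proj₁ (ys-legal j j<k)) , T-transport same-out _ (proj₂ (ys-legal j j<k)))
          ... | x∈ , x≢0 , T-ok =
            ≡.subst (_∈ Zs k) (≡.sym (same-xs k)) (drop-⊆ (suc m) (Zs k) (R.xs k) x∈) ,
            ≡.subst NonZero (≡.sym (same-xs k)) x≢0 ,
            T-transport (≡.sym ∘ same-out) _ T-ok

          wins′ : (∀ j → Zs j ⊆ Y × ys j ∈ Y ⟦ R′.ns j ⟧ × T (x ++ applyUpTo R′.out (2 *ℕ j +ℕ 2))) →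
            𝒜 (prepend x R′.out)
          wins′ legal-run = ext𝒜 _ _ (prepend-cong x (≡.sym ∘ same-out))
            (wins (shrink ∘ Zs) ys (λ j → shrink-⊆ (Zs j) (proj₁ (legal-run j)) ,
                                          y-legal j (proj₁ (proj₂ (legal-run j))) ,
                                          T-transport same-out _ (proj₂ (proj₂ (legal-run j)))))

      oddT : IWinsOdd T 𝒜 W x → IWinsOdd T 𝒜 Y x
      oddT (τ , legal , wins) = τ′ , Compare.legal′ , Compare.wins′
        where
        open StratOdd

        retarget : E × BlockSeq → E × BlockSeq
        retarget (y , Z) = y , shrink Z

        move : List (E × BlockSeq) → E × ℕ
        move h = σ τ (map retarget h)

        τ′ : StratOdd
        τ′ = record { n₀ = n₀ τ ⊔ m ; σ = λ h → proj₁ (move h) , proj₂ (move h) ⊔ m }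

        module Compare (Zs : ℕ → BlockSeq) (ys : ℕ → E) where
          module R′ = OddRun τ′ Zs ys
          module R  = OddRun τ (shrink ∘ Zs) ys

          same-move : ∀ k → move (R′.hist k) ≡ σ τ (R.hist k)
          same-move k = ≡.cong (σ τ) (map-applyUpTo _ retarget k)

          same-xs : ∀ k → R′.xs k ≡ R.xs k
          same-xs k = ≡.cong proj₁ (same-move (suc k))

          same-ns : ∀ k → R′.ns k ≡ R.ns k ⊔ m
          same-ns zero    = ≡.refl
          same-ns (suc k) = ≡.cong (λ r → proj₂ r ⊔ m) (same-move (suc k))

          same-out : R′.out ≗ R.out
          same-out = interleave-cong (λ _ → ≡.refl) same-xs

          y-legal : ∀ j → ys j ∈ Y ⟦ R′.ns j ⟧ → ys j ∈ W ⟦ R.ns j ⟧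
          y-legal j y∈ = ⊆[]-⟦⊔⟧ Y⊆W (ys j) (R.ns j) (≡.subst (λ n → ys j ∈ Y ⟦ n ⟧) (same-ns j) y∈)

          legal′ : ∀ k →
            (∀ j → j ≤ k → ys j ∈ Y ⟦ R′.ns j ⟧ × T (x ++ applyUpTo R′.out (2 *ℕ j +ℕ 1)) × Zs j ⊆ Y) →
            R′.xs k ∈ Zs k × NonZero (R′.xs k) × T (x ++ applyUpTo R′.out (2 *ℕ k +ℕ 2))
          legal′ k ys-legal with legal (shrink ∘ Zs) ys k (λ j j≤k → let (y∈ , T-ok , Z⊆Y) = ys-legal j j≤k in
            y-legal j y∈ , T-transport same-out _ T-ok , shrink-⊆ (Zs j) Z⊆Y)
          ... | x∈ , x≢0 , T-ok =
            ≡.subst (_∈ Zs k) (≡.sym (same-xs k)) (drop-⊆ (suc m) (Zs k) (R.xs k) x∈) ,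
            ≡.subst NonZero (≡.sym (same-xs k)) x≢0 ,
            T-transport (≡.sym ∘ same-out) _ T-ok

          wins′ : (∀ j → ys j ∈ Y ⟦ R′.ns j ⟧ × T (x ++ applyUpTo R′.out (2 *ℕ j +ℕ 1)) × Zs j ⊆ Y) →
            𝒜 (prepend x R′.out)
          wins′ legal-run = ext𝒜 _ _ (prepend-cong x (≡.sym ∘ same-out))
            (wins (shrink ∘ Zs) ys λ j → let (y∈ , T-ok , Z⊆Y) = legal-run j in
              y-legal j y∈ , T-transport same-out _ T-ok , shrink-⊆ (Zs j) Z⊆Y)

    strategy-transfer : ∀ {Y W m} → Y ⊆[ m ] W → ∀ x → IHasStrategy T 𝒜 W x → IHasStrategy T 𝒜 Y x
    strategy-transfer Y⊆W x with isEven (length x)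
    ... | true  = Transfer.evenT x Y⊆W
    ... | false = Transfer.oddT  x Y⊆W

    strategy-⊆ : ∀ {Y W} → Y ⊆ W → ∀ x → IHasStrategy T 𝒜 W x → IHasStrategy T 𝒜 Y x
    strategy-⊆ {Y} {W} Y⊆W = strategy-transfer (⊆⇒⊆[] {Y} {W} 0 Y⊆W)

    module Relabel (extT : ExtT T) {x x′ : List E} (x≈x′ : Pointwise _≈E_ x x′) (Y : BlockSeq) where

      T⇒ : ∀ l → T (x ++ l) → T (x′ ++ l)
      T⇒ l = extT _ _ (Pointwise.++⁺ x≈x′ Pointwise-≈E-refl)

      T⇐ : ∀ l → T (x′ ++ l) → T (x ++ l)
      T⇐ l = extT _ _ (Pointwise.++⁺ (Pointwise-≈E-sym x≈x′) Pointwise-≈E-refl)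

      evenR : IWinsEven T 𝒜 Y x → IWinsEven T 𝒜 Y x′
      evenR (σ , legal , wins) = σ ,
        (λ Zs ys k Zs⊆Y ys-legal →
           map₂ (map₂ (T⇒ _)) (legal Zs ys k Zs⊆Y λ j j<k → map₂ (T⇐ _) (ys-legal j j<k))) ,
        (λ Zs ys legal-run →
           ext𝒜 _ _ (prepend-resp _ x≈x′) (wins Zs ys λ j → map₂ (map₂ (T⇐ _)) (legal-run j)))

      oddR : IWinsOdd T 𝒜 Y x → IWinsOdd T 𝒜 Y x′
      oddR (τ , legal , wins) = τ ,
        (λ Zs ys k ys-legal →
           map₂ (map₂ (T⇒ _)) (legal Zs ys k λ j j≤k → map₂ (map₁ (T⇐ _)) (ys-legal j j≤k))) ,
        (λ Zs ys legal-run →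
           ext𝒜 _ _ (prepend-resp _ x≈x′) (wins Zs ys λ j → map₂ (map₁ (T⇐ _)) (legal-run j)))

    strategy-resp : ExtT T → ∀ {Y x x′} → Pointwise _≈E_ x x′ →
      IHasStrategy T 𝒜 Y x → IHasStrategy T 𝒜 Y x′
    strategy-resp extT {Y} {x} x≈x′ rewrite ≡.sym (Pointwise.Pointwise-length x≈x′) with isEven (length x)
    ... | true  = Relabel.evenR extT x≈x′ Y
    ... | false = Relabel.oddR  extT x≈x′ Y

  module _ (lem : ExcludedMiddle 0ℓ) where

    outside-supp : ∀ z p → ¬ (p ∈supp z) → coef z p ≈ 0#
    outside-supp z p = em⇒dne lem

    module Diagonal (Xs : ℕ → BlockSeq) (Xs-nested : ∀ n → Xs (suc n) ⊆ Xs n) where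

      Xs-antitone : ∀ {m n} → m ≤′ n → Xs n ⊆ Xs m
      Xs-antitone {n = n} ≤′-refl = ⊆-refl {Xs n}
      Xs-antitone (≤′-step m≤′n) z z∈ = Xs-antitone m≤′n z (Xs-nested _ z z∈)

      diag : ℕ → E
      threshold : ℕ → ℕ

      diag n = vec (Xs n) (threshold n)

      threshold zero    = 0
      threshold (suc n) = bound (diag n)

      threshold≤supp : ∀ n {s} → s ∈supp diag n → threshold n ≤ s
      threshold≤supp n = index≤supp (Xs n) (threshold n)

      threshold-step : ∀ n → threshold n ≤ threshold (suc n)
      threshold-step n with nz (Xs n) (threshold n)
      ... | s , s∈ = ℕ.<⇒≤ (ℕ.≤-<-trans (threshold≤supp n s∈) (supp<bound (diag n) s∈))

      threshold-mono : ∀ {m n} → m ≤′ n → threshold m ≤ threshold n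
      threshold-mono ≤′-refl        = ℕ.≤-refl
      threshold-mono (≤′-step m≤′n) = ℕ.≤-trans (threshold-mono m≤′n) (threshold-step _)

      diagonal : BlockSeq
      diagonal = record
        { vec   = diag
        ; nz    = λ n → nz (Xs n) (threshold n)
        ; block = λ n s t s∈ t∈ → ℕ.<-≤-trans (supp<bound (diag n) s∈) (threshold≤supp (suc n) t∈)
        }

      diag∈Xs : ∀ {m n} → m ≤′ n → diag n ∈ Xs m
      diag∈Xs {n = n} m≤′n = Xs-antitone m≤′n (diag n) (vec∈ (Xs n) (threshold n))

      diagonal-⊆ : diagonal ⊆ Xs 0
      diagonal-⊆ = ⊆-from-vec∈ diagonal (Xs 0) λ i → diag∈Xs (ℕ.≤⇒≤′ z≤n)

      diagonal-⊆[] : ∀ n → diagonal ⊆[ threshold n ] Xs n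
      diagonal-⊆[] n = mk⊆[] λ z (z∈ , _ , above) →
        drop-⊆Xs z (∈-drop {z} diagonal n (threshold n) head-high tail-low (z-low z above) z∈)
        where
        drop-⊆Xs : drop n diagonal ⊆ Xs n
        drop-⊆Xs = ⊆-from-vec∈ (drop n diagonal) (Xs n) λ j → diag∈Xs (ℕ.≤⇒≤′ (ℕ.m≤n+m n j))

        head-high : ∀ i p → i < n → threshold n ≤ p → coef (diag i) p ≈ 0#
        head-high i p i<n t≤p = fin (diag i) p (ℕ.≤-trans (threshold-mono (ℕ.≤⇒≤′ i<n)) t≤p)

        tail-low : ∀ j p → p < threshold n → coef (diag (j +ℕ n)) p ≈ 0#
        tail-low j p p<t = outside-supp (diag (j +ℕ n)) p λ p∈ → ℕ.<⇒≱ p<t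
          (ℕ.≤-trans (threshold-mono (ℕ.≤⇒≤′ (ℕ.m≤n+m n j))) (threshold≤supp (j +ℕ n) p∈))

        z-low : ∀ z → (∀ s → s ∈supp z → threshold n < s) → ∀ p → p < threshold n → coef z p ≈ 0#
        z-low z above p p<t = outside-supp z p λ p∈ → ℕ.<-asym p<t (above p p∈)

    module Fusion (T : List E → Set) (extT : ExtT T) (𝒜 : (ℕ → E) → Set) (ext𝒜 : ExtA 𝒜)
                  (V : BlockSeq) where
      open Strategies T 𝒜 ext𝒜

      Winnable : ℕ → BlockSeq → Set
      Winnable n W = ∃ λ Y → Y ⊆ W × IHasStrategy T 𝒜 Y (codeAt n)

      shrinkTo : ∀ n W → Σ BlockSeq λ Y → Y ⊆ W × (Winnable n W → IHasStrategy T 𝒜 Y (codeAt n))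
      shrinkTo n W with lem {Winnable n W}
      ... | yes (Y , Y⊆W , wins) = Y , Y⊆W , const wins
      ... | no  ¬winnable        = W , ⊆-refl {W} , λ winnable → contradiction winnable ¬winnable

      stages : ℕ → BlockSeq
      stages zero    = V
      stages (suc n) = proj₁ (shrinkTo n (stages n))

      open Diagonal stages (λ n → proj₁ (proj₂ (shrinkTo n (stages n)))) public

      wins-some⇒wins-all : ∀ x → (∃ λ Y → Y ⊆ diagonal × IHasStrategy T 𝒜 Y x) →
        ∀ Y → Y ⊆ diagonal → IHasStrategy T 𝒜 Y x
      wins-some⇒wins-all x (Y₀ , Y₀⊆X , wins₀) Y Y⊆X with codeAt-surjective x
      ... | n , code≈x = strategy-resp extT {Y} code≈x
          (strategy-transfer (⊆-⊆[]-trans {Y} Y⊆X (diagonal-⊆[] (suc n))) (codeAt n) winsₙ₊₁)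
        where
        Y₀′ : BlockSeq
        Y₀′ = drop (suc (threshold n)) Y₀

        Y₀′-⊆ : Y₀′ ⊆ stages n
        Y₀′-⊆ = drop-suc-⊆ (⊆-⊆[]-trans {Y₀} Y₀⊆X (diagonal-⊆[] n))

        wins₀′ : IHasStrategy T 𝒜 Y₀′ (codeAt n)
        wins₀′ = strategy-⊆ {Y₀′} {Y₀} (drop-⊆ (suc (threshold n)) Y₀) (codeAt n)
          (strategy-resp extT {Y₀} (Pointwise-≈E-sym code≈x) wins₀)

        winsₙ₊₁ : IHasStrategy T 𝒜 (stages (suc n)) (codeAt n)
        winsₙ₊₁ = proj₂ (proj₂ (shrinkTo n (stages n))) (Y₀′ , Y₀′-⊆ , wins₀′)

      wins-some⇔wins-all : ∀ x → (∃ λ Y → Y ⊆ diagonal × IHasStrategy T 𝒜 Y x) ⇔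
        (∀ Y → Y ⊆ diagonal → IHasStrategy T 𝒜 Y x)
      wins-some⇔wins-all x = mk⇔ (wins-some⇒wins-all x)
        (λ wins → diagonal , ⊆-refl {diagonal} , wins diagonal (⊆-refl {diagonal}))

lemma1 : ExcludedMiddle 0ℓ → (𝔽 : CountableField) → let open Space 𝔽 in
    (𝒜 : (ℕ → E) → Set) → ExtA 𝒜 →
    (V : BlockSeq) (v : List E) (T : List E → Set) → ExtT T → IsRule V v T →
    ∃ λ (X : BlockSeq) → X ⊆ V ×
      (∀ x → T x →
        (∃ λ (Y : BlockSeq) → Y ⊆ X × IHasStrategy T 𝒜 Y x)
        ⇔ (∀ (Y : BlockSeq) → Y ⊆ X → IHasStrategy T 𝒜 Y x))
lemma1 lem 𝔽 𝒜 ext𝒜 V _ T extT _ = diagonal , diagonal-⊆ , λ x _ → wins-some⇔wins-all x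
  where open Fusion 𝔽 lem T extT 𝒜 ext𝒜 V
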